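{- Let $X$ and $Y$ be directed graphs with vertex set $[n]$, and let $a,b\in[n]$ be such that $a\to b$ is an edge of $X$ and $\{a,b\}$ is a self-equivalent set of $X$. Then \[ \mathrm{ODP}(X,Y)_{a\to b}=x\,\mathrm{ODP}(X,Y)_{b\to a}. \]
   Context: Directed graphs are finite, without loops or multiple edges, and no two vertices are joined by edges in both directions. A subset $S\subseteq[n]$ is self-equivalent in $X$ if for every $t\in[n]\setminus S$, either every $s\in S$ has an edge $s\to t$ in $X$, or $t\to s$ is an edge of $X$ for every $s\in S$, or there is no edge between $t$ and any element of $S$. For directed graphs $X,Y$ on $[n]$, $\mathrm{DFS}(X,Y)$ is the directed graph whose vertices are the permutations $\sigma$ of $[n]$, with a directed edge from $\sigma$ to $\sigma\circ(c\;d)$ whenever $c\ne d$, $c\to d$ is an edge of $X$ and $\sigma(c)\to\sigma(d)$ is an edge of $Y$ ($\sigma\circ(c\;d)$ agrees with $\sigma$ except it sends $c$ to $\sigma(d)$ and $d$ to $\sigma(c)$). For vertices $c,d$, $\mathrm{ODP}(X,Y)_{c\to d}$ is the sum of $x^{\mathrm{outdeg}(\sigma)}$ (outdegree in $\mathrm{DFS}(X,Y)$) over all permutations $\sigma$ for which $\sigma(c)\to\sigma(d)$ is an edge of $Y$. -}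

module Defs where

open import Data.Bool using (Bool; true; false; _∧_; _∨_; not; if_then_else_)
open import Data.Nat using (ℕ; zero; suc)
import Data.Nat
open import Data.Fin using (Fin)
open import Data.Fin.Properties using (_≟_)
open import Data.Fin.Subset using (Subset; _∈_; _∉_; _∪_; ⁅_⁆)
open import Data.List using (List; []; _∷_; [_]; map; concatMap; length; filterᵇ; allFin)
open import Data.Bool.ListAction using (any; all)
open import Data.Vec using (Vec; []; _∷_; lookup; tabulate)
import Data.Vec.Properties as VecP
open import Data.Product using (_×_)
open import Data.Sum using (_⊎_)
open import Relation.Nullary using (¬_; ⌊_⌋)
open import Relation.Binary.PropositionalEquality using (_≡_)

record DiGraph (n : ℕ) : Set where
  field
    adj      : Fin n → Fin n → Bool
    loopless : ∀ c → adj c c ≡ false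
    asym     : ∀ c d → adj c d ≡ true → adj d c ≡ false
open DiGraph public

Edge : ∀ {n} → DiGraph n → Fin n → Fin n → Set
Edge G c d = adj G c d ≡ true

SelfEquivalent : ∀ {n} → DiGraph n → Subset n → Set
SelfEquivalent {n} X S =
  ∀ (t : Fin n) → t ∉ S →
      (∀ s → s ∈ S → Edge X s t)
    ⊎ (∀ s → s ∈ S → Edge X t s)
    ⊎ (∀ s → s ∈ S → ¬ Edge X s t × ¬ Edge X t s)

_==_ : ∀ {n} → Fin n → Fin n → Bool
i == j = ⌊ i ≟ j ⌋

allMaps : ∀ {n} (m : ℕ) → List (Vec (Fin n) m)
allMaps zero = [ [] ]
allMaps {n} (suc m) = concatMap (λ x → map (x ∷_) (allMaps m)) (allFin n)

isInjective : ∀ {n} → Vec (Fin n) n → Bool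
isInjective {n} σ =
  all (λ i → all (λ j → not (lookup σ i == lookup σ j) ∨ (i == j)) (allFin n)) (allFin n)

-- All permutations of [n] (σ is represented by the vector (σ(0),…,σ(n-1))).
Perms : (n : ℕ) → List (Vec (Fin n) n)
Perms n = filterᵇ isInjective (allMaps n)

-- σ ∘ (c d)
swapAt : ∀ {n} → Vec (Fin n) n → Fin n → Fin n → Vec (Fin n) n
swapAt σ c d = tabulate λ i →
  if i == c then lookup σ d else if i == d then lookup σ c else lookup σ i

vecEq : ∀ {n} → Vec (Fin n) n → Vec (Fin n) n → Bool
vecEq σ τ = ⌊ VecP.≡-dec _≟_ σ τ ⌋

dfsEdge : ∀ {n} → DiGraph n → DiGraph n → Vec (Fin n) n → Vec (Fin n) n → Bool
dfsEdge {n} X Y σ τ =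
  any (λ c → any (λ d →
      not (c == d) ∧ adj X c d ∧ adj Y (lookup σ c) (lookup σ d)
      ∧ vecEq τ (swapAt σ c d)) (allFin n)) (allFin n)

outdeg : ∀ {n} → DiGraph n → DiGraph n → Vec (Fin n) n → ℕ
outdeg {n} X Y σ = length (filterᵇ (dfsEdge X Y σ) (Perms n))

-- Polynomials in x with coefficients in ℕ, as coefficient sequences.
Poly : Set
Poly = ℕ → ℕ

x·_ : Poly → Poly
(x· p) zero = 0
(x· p) (suc k) = p k

ODP : ∀ {n} → DiGraph n → DiGraph n → Fin n → Fin n → Poly
ODP {n} X Y c d k =
  length (filterᵇ (λ σ → adj Y (lookup σ c) (lookup σ d) ∧ ⌊ Data.Nat._≟_ (outdeg X Y σ) k ⌋) (Perms n))

{-# OPTIONS --safe #-}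

-- Write σ′ = σ ∘ (a b). Because {a, b} is self-equivalent, the transposition (a b) maps
-- every edge of X other than a → b (and b → a, which is absent) to an edge of X.
-- Hence, if σ(a) → σ(b) is an edge of Y, then ρ ↦ ρ ∘ (a b) is a bijection from the
-- out-neighbours of σ in DFS(X,Y) other than σ′ onto the out-neighbours of σ′; and σ′ is an
-- out-neighbour of σ, via the move (a b). So outdeg σ = 1 + outdeg σ′, and the involution
-- σ ↦ σ′ of the permutations carries those counted by the coefficient of x^(k+1) in
-- ODP_{a→b} onto those counted by the coefficient of x^k in ODP_{b→a}.

module Submission where

open import Defs
open import Data.Bool using (Bool; true; false; T; _∧_; _∨_; not; if_then_else_)
open import Data.Bool.ListAction using (all)
open import Data.Bool.Properties using (T-≡; T-∧; T-∨; ¬-not; ⇔→≡)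
open import Data.Empty using (⊥)
open import Data.Fin using (Fin)
open import Data.Fin.Permutation.Components using (transpose)
open import Data.Fin.Properties using (_≟_)
open import Data.Fin.Subset using (_∪_; ⁅_⁆) renaming (_∈_ to _∈ₛ_; _∉_ to _∉ₛ_)
open import Data.Fin.Subset.Properties using (x∈⁅x⁆; x≢y⇒x∉⁅y⁆; x∈p∪q⁺; x∈p∪q⁻)
open import Data.List
  using ([]; _∷_; _++_; map; concatMap; cartesianProductWith; length; filterᵇ; allFin)
open import Data.List.Membership.Propositional using (_∈_; lose)
open import Data.List.Membership.Propositional.Properties
  using (∈-map⁺; ∈-map⁻; ∈-allFin; ∈-cartesianProductWith⁺; ∈-filter⁺; ∈-filter⁻)
open import Data.List.Membership.Propositional.Properties.WithK using (unique∧set⇒bag)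
open import Data.List.Properties using (filter-none)
open import Data.List.Relation.Binary.BagAndSetEquality using (∼bag⇒↭)
open import Data.List.Relation.Binary.Permutation.Propositional using (_↭_)
open import Data.List.Relation.Binary.Permutation.Propositional.Properties using (↭-length; filter-↭)
open import Data.List.Relation.Unary.All as All using (All)
open import Data.List.Relation.Unary.All.Properties using (all⁺; all⁻)
open import Data.List.Relation.Unary.Any using (here; there; satisfied)
open import Data.List.Relation.Unary.Any.Properties using (any⁺; any⁻)
open import Data.List.Relation.Unary.Unique.Propositional using (Unique; []; _∷_)
open import Data.List.Relation.Unary.Unique.Propositional.Properties
  using (map⁺; cartesianProductWith⁺; allFin⁺; filter⁺)
open import Data.Nat using (ℕ; zero; suc)
import Data.Nat as ℕ
open import Data.Nat.Properties using (suc-injective)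
open import Data.Product as Product using (_×_; _,_; proj₁; proj₂; ∃₂)
open import Data.Sum using (inj₁; inj₂; [_,_]′)
open import Data.Vec using (Vec; []; _∷_; lookup)
open import Data.Vec.Properties using (≡-dec; lookup∘tabulate; tabulate∘lookup; tabulate-cong; ∷-injective)
open import Function using (_∘_; _⇔_; mk⇔; Equivalence; Injective)
import Function.Properties.Equivalence as ⇔
open import Level using (Level)
open import Relation.Nullary using (¬_; Dec; yes; no; ⌊_⌋; isYes; contradiction)
open import Relation.Nullary.Decidable using (T?; dec-true; dec-false; toWitness; fromWitness; toWitnessFalse; fromWitnessFalse)
open import Relation.Binary.PropositionalEquality

private
  variable
    ℓ : Level
    A B C : Set ℓ

length-filterᵇ-map : ∀ (P : A → Bool) (f : B → A) xs →
                     length (filterᵇ P (map f xs)) ≡ length (filterᵇ (P ∘ f) xs)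
length-filterᵇ-map P f [] = refl
length-filterᵇ-map P f (x ∷ xs) with P (f x)
... | true  = cong suc (length-filterᵇ-map P f xs)
... | false = length-filterᵇ-map P f xs

filterᵇ-cong-∈ : ∀ {P Q : A → Bool} xs → (∀ {x} → x ∈ xs → P x ≡ Q x) →
                 filterᵇ P xs ≡ filterᵇ Q xs
filterᵇ-cong-∈ [] _ = refl
filterᵇ-cong-∈ {P = P} {Q} (x ∷ xs) P≗Q with P x | Q x | P≗Q (here refl)
... | true  | .true  | refl = cong (x ∷_) (filterᵇ-cong-∈ xs (P≗Q ∘ there))
... | false | .false | refl = filterᵇ-cong-∈ xs (P≗Q ∘ there)

↭-map-involution : ∀ {f : A → A} {xs} → (∀ x → f (f x) ≡ x) →
                   (∀ {x} → x ∈ xs → f x ∈ xs) → Unique xs → xs ↭ map f xs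
↭-map-involution {f = f} {xs} f-involutive closed xs! =
  ∼bag⇒↭ (unique∧set⇒bag xs! (map⁺ f-injective xs!) (mk⇔ into back))
  where
  f-injective : ∀ {x y} → f x ≡ f y → x ≡ y
  f-injective {x} {y} fx≡fy = trans (sym (f-involutive x)) (trans (cong f fx≡fy) (f-involutive y))
  into : ∀ {x} → x ∈ xs → x ∈ map f xs
  into {x} x∈xs = subst (_∈ map f xs) (f-involutive x) (∈-map⁺ f (closed x∈xs))
  back : ∀ {x} → x ∈ map f xs → x ∈ xs
  back x∈fxs with y , y∈xs , refl ← ∈-map⁻ f x∈fxs = closed y∈xs

length-filterᵇ-involution : ∀ (P : A → Bool) {f : A → A} {xs} → (∀ x → f (f x) ≡ x) →
                            (∀ {x} → x ∈ xs → f x ∈ xs) → Unique xs →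
                            length (filterᵇ P xs) ≡ length (filterᵇ (P ∘ f) xs)
length-filterᵇ-involution P {f} {xs} f-involutive closed xs! =
  trans (↭-length (filter-↭ (T? ∘ P) (↭-map-involution f-involutive closed xs!)))
        (length-filterᵇ-map P f xs)

length-filterᵇ-except : ∀ {P Q : A → Bool} {x xs} → Unique xs → x ∈ xs →
                        P x ≡ true → Q x ≡ false → (∀ y → y ≢ x → P y ≡ Q y) →
                        length (filterᵇ P xs) ≡ suc (length (filterᵇ Q xs))
length-filterᵇ-except (x∉xs ∷ xs!) (here refl) Px Qx P≗Q rewrite Px | Qx =
  cong (suc ∘ length) (filterᵇ-cong-∈ _ λ y∈xs → P≗Q _ (All.lookup x∉xs y∈xs ∘ sym))
length-filterᵇ-except {P = P} {Q} {xs = y ∷ xs} (y∉xs ∷ xs!) (there x∈xs) Px Qx P≗Q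
  with P y | Q y | P≗Q y (All.lookup y∉xs x∈xs)
... | true  | .true  | refl = cong suc (length-filterᵇ-except xs! x∈xs Px Qx P≗Q)
... | false | .false | refl = length-filterᵇ-except xs! x∈xs Px Qx P≗Q

concatMap-map≡cartesianProductWith : ∀ (f : A → B → C) xs ys →
  concatMap (λ x → map (f x) ys) xs ≡ cartesianProductWith f xs ys
concatMap-map≡cartesianProductWith f [] ys = refl
concatMap-map≡cartesianProductWith f (x ∷ xs) ys =
  cong (map (f x) ys ++_) (concatMap-map≡cartesianProductWith f xs ys)

module _ {n : ℕ} where

  allMaps-suc : ∀ m → allMaps {n} (suc m) ≡ cartesianProductWith _∷_ (allFin n) (allMaps m)
  allMaps-suc m = concatMap-map≡cartesianProductWith _∷_ (allFin n) (allMaps m)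

  allMaps-unique : ∀ m → Unique (allMaps {n} m)
  allMaps-unique zero = All.[] ∷ []
  allMaps-unique (suc m) rewrite allMaps-suc m =
    cartesianProductWith⁺ _∷_ ∷-injective (allFin⁺ n) (allMaps-unique m)

  ∈-allMaps : ∀ {m} (v : Vec (Fin n) m) → v ∈ allMaps m
  ∈-allMaps [] = here refl
  ∈-allMaps {suc m} (x ∷ v) rewrite allMaps-suc m =
    ∈-cartesianProductWith⁺ _∷_ (∈-allFin x) (∈-allMaps v)

  private
    injectivity-test : Vec (Fin n) n → Fin n → Fin n → Bool
    injectivity-test σ i j = not (lookup σ i == lookup σ j) ∨ (i == j)

  isInjective-sound : ∀ (σ : Vec (Fin n) n) → T (isInjective σ) → Injective _≡_ _≡_ (lookup σ)
  isInjective-sound σ σ! {i} {j} σi≡σj with Equivalence.to (T-∨ {not (lookup σ i == lookup σ j)}) entry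
    where
    row : All (T ∘ injectivity-test σ i) (allFin n)
    row = all⁺ _ _ (All.lookup (all⁺ (λ i → all (injectivity-test σ i) (allFin n)) _ σ!) (∈-allFin i))
    entry : T (injectivity-test σ i j)
    entry = All.lookup row (∈-allFin j)
  ... | inj₁ σi≢σj = contradiction σi≡σj (toWitnessFalse {a? = lookup σ i ≟ lookup σ j} σi≢σj)
  ... | inj₂ i≡j   = toWitness {a? = i ≟ j} i≡j

  isInjective-complete : ∀ (σ : Vec (Fin n) n) → Injective _≡_ _≡_ (lookup σ) → T (isInjective σ)
  isInjective-complete σ σ! =
    all⁻ (λ i → all (injectivity-test σ i) (allFin n)) {allFin n}
      (All.tabulate λ {i} _ → all⁻ (injectivity-test σ i) {allFin n} (All.tabulate λ {j} _ → entry i j))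
    where
    entry : ∀ i j → T (injectivity-test σ i j)
    entry i j with lookup σ i ≟ lookup σ j
    ... | yes σi≡σj = fromWitness (σ! σi≡σj)
    ... | no _      = _

  Perms-unique : Unique (Perms n)
  Perms-unique = filter⁺ (T? ∘ isInjective) (allMaps-unique n)

  ∈-Perms⁺ : ∀ σ → Injective _≡_ _≡_ (lookup σ) → σ ∈ Perms n
  ∈-Perms⁺ σ σ! = ∈-filter⁺ (T? ∘ isInjective) (∈-allMaps σ) (isInjective-complete σ σ!)

  ∈-Perms⁻ : ∀ {σ} → σ ∈ Perms n → Injective _≡_ _≡_ (lookup σ)
  ∈-Perms⁻ {σ} σ∈ = isInjective-sound σ (proj₂ (∈-filter⁻ (T? ∘ isInjective) {xs = allMaps n} σ∈))

module _ {n : ℕ} where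

  transpose-matchˡ : ∀ (i j : Fin n) → transpose i j i ≡ j
  transpose-matchˡ i j rewrite dec-true (i ≟ i) refl = refl

  transpose-matchʳ : ∀ (i j : Fin n) → transpose i j j ≡ i
  transpose-matchʳ i j with j ≟ i
  ... | yes j≡i = j≡i
  ... | no _ rewrite dec-true (j ≟ j) refl = refl

  transpose-fix : ∀ {i j k : Fin n} → k ≢ i → k ≢ j → transpose i j k ≡ k
  transpose-fix {i} {j} {k} k≢i k≢j rewrite dec-false (k ≟ i) k≢i | dec-false (k ≟ j) k≢j = refl

  transpose-involutive : ∀ (i j k : Fin n) → transpose i j (transpose i j k) ≡ k
  transpose-involutive i j k = by-cases (k ≟ i) (k ≟ j)
    where
    by-cases : Dec (k ≡ i) → Dec (k ≡ j) → transpose i j (transpose i j k) ≡ k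
    by-cases (yes refl) _ = trans (cong (transpose k j) (transpose-matchˡ k j)) (transpose-matchʳ k j)
    by-cases (no _) (yes refl) = trans (cong (transpose i k) (transpose-matchʳ i k)) (transpose-matchˡ i k)
    by-cases (no k≢i) (no k≢j) = trans (cong (transpose i j) (transpose-fix k≢i k≢j)) (transpose-fix k≢i k≢j)

  transpose-conjugate : ∀ {f : Fin n → Fin n} → (∀ k → f (f k) ≡ k) →
                        ∀ c d k → f (transpose c d (f k)) ≡ transpose (f c) (f d) k
  transpose-conjugate {f} f-involutive c d k = by-cases (k ≟ f c) (k ≟ f d)
    where
    open ≡-Reasoning
    by-cases : Dec (k ≡ f c) → Dec (k ≡ f d) → f (transpose c d (f k)) ≡ transpose (f c) (f d) k
    by-cases (yes refl) _ = begin
      f (transpose c d (f (f c))) ≡⟨ cong (f ∘ transpose c d) (f-involutive c) ⟩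
      f (transpose c d c)         ≡⟨ cong f (transpose-matchˡ c d) ⟩
      f d                         ≡⟨ transpose-matchˡ (f c) (f d) ⟨
      transpose (f c) (f d) (f c) ∎
    by-cases (no _) (yes refl) = begin
      f (transpose c d (f (f d))) ≡⟨ cong (f ∘ transpose c d) (f-involutive d) ⟩
      f (transpose c d d)         ≡⟨ cong f (transpose-matchʳ c d) ⟩
      f c                         ≡⟨ transpose-matchʳ (f c) (f d) ⟨
      transpose (f c) (f d) (f d) ∎
    by-cases (no k≢fc) (no k≢fd) = begin
      f (transpose c d (f k)) ≡⟨ cong f (transpose-fix (k≢fc ∘ moved) (k≢fd ∘ moved)) ⟩
      f (f k)                 ≡⟨ f-involutive k ⟩
      k                       ≡⟨ transpose-fix k≢fc k≢fd ⟨
      transpose (f c) (f d) k ∎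
      where
      moved : ∀ {x} → f k ≡ x → k ≡ f x
      moved refl = sym (f-involutive k)

  lookup-ext : ∀ {u v : Vec A n} → (∀ i → lookup u i ≡ lookup v i) → u ≡ v
  lookup-ext {u = u} {v} u≗v = trans (sym (tabulate∘lookup u)) (trans (tabulate-cong u≗v) (tabulate∘lookup v))

  lookup-swapAt : ∀ (σ : Vec (Fin n) n) c d i → lookup (swapAt σ c d) i ≡ lookup σ (transpose c d i)
  lookup-swapAt σ c d i = trans (lookup∘tabulate _ i) swap-case
    where
    swap-case : (if isYes (i ≟ c) then lookup σ d else if isYes (i ≟ d) then lookup σ c else lookup σ i)
                ≡ lookup σ (transpose c d i)
    swap-case with i ≟ c
    ... | yes _ = refl
    ... | no _ with i ≟ d
    ...   | yes _ = refl
    ...   | no _  = refl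

  lookup-swapAt-transpose : ∀ (σ : Vec (Fin n) n) c d i → lookup (swapAt σ c d) (transpose c d i) ≡ lookup σ i
  lookup-swapAt-transpose σ c d i =
    trans (lookup-swapAt σ c d _) (cong (lookup σ) (transpose-involutive c d i))

  lookup-swapAtˡ : ∀ (σ : Vec (Fin n) n) c d → lookup (swapAt σ c d) c ≡ lookup σ d
  lookup-swapAtˡ σ c d = trans (lookup-swapAt σ c d c) (cong (lookup σ) (transpose-matchˡ c d))

  lookup-swapAtʳ : ∀ (σ : Vec (Fin n) n) c d → lookup (swapAt σ c d) d ≡ lookup σ c
  lookup-swapAtʳ σ c d = trans (lookup-swapAt σ c d d) (cong (lookup σ) (transpose-matchʳ c d))

  swapAt-involutive : ∀ (c d : Fin n) σ → swapAt (swapAt σ c d) c d ≡ σ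
  swapAt-involutive c d σ = lookup-ext λ i →
    trans (lookup-swapAt (swapAt σ c d) c d i) (lookup-swapAt-transpose σ c d i)

  swapAt-swapAt : ∀ (a b c d : Fin n) ρ →
                  swapAt (swapAt ρ c d) a b ≡ swapAt (swapAt ρ a b) (transpose a b c) (transpose a b d)
  swapAt-swapAt a b c d ρ = lookup-ext λ i → begin
    lookup (swapAt (swapAt ρ c d) a b) i       ≡⟨ lookup-swapAt (swapAt ρ c d) a b i ⟩
    lookup (swapAt ρ c d) (π i)                ≡⟨ lookup-swapAt ρ c d (π i) ⟩
    lookup ρ (transpose c d (π i))             ≡⟨ cong (lookup ρ) (transpose-involutive a b _) ⟨
    lookup ρ (π (π (transpose c d (π i))))     ≡⟨ cong (lookup ρ ∘ π) (transpose-conjugate (transpose-involutive a b) c d i) ⟩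
    lookup ρ (π (transpose (π c) (π d) i))     ≡⟨ lookup-swapAt ρ a b _ ⟨
    lookup (swapAt ρ a b) (transpose (π c) (π d) i) ≡⟨ lookup-swapAt (swapAt ρ a b) (π c) (π d) i ⟨
    lookup (swapAt (swapAt ρ a b) (π c) (π d)) i ∎
    where
    open ≡-Reasoning
    π = transpose a b

  swapAt-injective : ∀ (σ : Vec (Fin n) n) c d → Injective _≡_ _≡_ (lookup σ) →
                     Injective _≡_ _≡_ (lookup (swapAt σ c d))
  swapAt-injective σ c d σ! {i} {j} σ′i≡σ′j = begin
    i                                   ≡⟨ transpose-involutive c d i ⟨
    transpose c d (transpose c d i)     ≡⟨ cong (transpose c d) (σ! (begin
      lookup σ (transpose c d i)    ≡⟨ lookup-swapAt σ c d i ⟨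
      lookup (swapAt σ c d) i       ≡⟨ σ′i≡σ′j ⟩
      lookup (swapAt σ c d) j       ≡⟨ lookup-swapAt σ c d j ⟩
      lookup σ (transpose c d j)    ∎)) ⟩
    transpose c d (transpose c d j)     ≡⟨ transpose-involutive c d j ⟩
    j                                   ∎
    where open ≡-Reasoning

  swapAt-∈-Perms : ∀ {σ} c d → σ ∈ Perms n → swapAt σ c d ∈ Perms n
  swapAt-∈-Perms {σ} c d σ∈ = ∈-Perms⁺ (swapAt σ c d) (swapAt-injective σ c d (∈-Perms⁻ σ∈))

module _ {n : ℕ} (X : DiGraph n) {a b : Fin n} (se : SelfEquivalent X (⁅ a ⁆ ∪ ⁅ b ⁆)) where

  private
    π : Fin n → Fin n
    π = transpose a b

  pair-uniform : ∀ {t} → t ∉ₛ ⁅ a ⁆ ∪ ⁅ b ⁆ →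
                 ∃₂ λ β γ → ∀ s → s ∈ₛ ⁅ a ⁆ ∪ ⁅ b ⁆ → adj X s t ≡ β × adj X t s ≡ γ
  pair-uniform {t} t∉ with se t t∉
  ... | inj₁ out         = true , false , λ s s∈ → out s s∈ , asym X s t (out s s∈)
  ... | inj₂ (inj₁ in′)  = false , true , λ s s∈ → asym X t s (in′ s s∈) , in′ s s∈
  ... | inj₂ (inj₂ none) = false , false , λ s s∈ → ¬-not (proj₁ (none s s∈)) , ¬-not (proj₂ (none s s∈))

  pair-indistinguishable : ∀ {t} → t ≢ a → t ≢ b → adj X a t ≡ adj X b t × adj X t a ≡ adj X t b
  pair-indistinguishable t≢a t≢b
    with _ , _ , uniform ← pair-uniform ([ x≢y⇒x∉⁅y⁆ t≢a , x≢y⇒x∉⁅y⁆ t≢b ]′ ∘ x∈p∪q⁻ _ _)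
    with at≡β , ta≡γ ← uniform a (x∈p∪q⁺ (inj₁ (x∈⁅x⁆ a)))
    with bt≡β , tb≡γ ← uniform b (x∈p∪q⁺ (inj₂ (x∈⁅x⁆ b)))
    = trans at≡β (sym bt≡β) , trans ta≡γ (sym tb≡γ)

  adj-transpose-away : ∀ {t} → t ≢ a → t ≢ b → ∀ u → adj X (π u) t ≡ adj X u t × adj X t (π u) ≡ adj X t u
  adj-transpose-away {t} t≢a t≢b u = by-cases (u ≟ a) (u ≟ b)
    where
    by-cases : Dec (u ≡ a) → Dec (u ≡ b) → adj X (π u) t ≡ adj X u t × adj X t (π u) ≡ adj X t u
    by-cases (yes refl) _ rewrite transpose-matchˡ a b =
      Product.map sym sym (pair-indistinguishable t≢a t≢b)
    by-cases (no _) (yes refl) rewrite transpose-matchʳ a b = pair-indistinguishable t≢a t≢b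
    by-cases (no u≢a) (no u≢b) rewrite transpose-fix u≢a u≢b = refl , refl

  adj-transpose : ∀ {c d} → ¬ (c ≡ a × d ≡ b) → ¬ (c ≡ b × d ≡ a) → adj X (π c) (π d) ≡ adj X c d
  adj-transpose {c} {d} ¬ab ¬ba = by-cases (c ≟ a) (c ≟ b) (d ≟ a) (d ≟ b)
    where
    loop : ∀ {u} → adj X (π u) (π u) ≡ adj X u u
    loop = trans (loopless X _) (sym (loopless X _))
    by-cases : Dec (c ≡ a) → Dec (c ≡ b) → Dec (d ≡ a) → Dec (d ≡ b) → adj X (π c) (π d) ≡ adj X c d
    by-cases _ _ (no d≢a) (no d≢b) rewrite transpose-fix d≢a d≢b = proj₁ (adj-transpose-away d≢a d≢b c)
    by-cases (no c≢a) (no c≢b) _ _ rewrite transpose-fix c≢a c≢b = proj₂ (adj-transpose-away c≢a c≢b d)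
    by-cases (yes refl) _ (yes refl) _ = loop
    by-cases (yes refl) _ _ (yes refl) = contradiction (refl , refl) ¬ab
    by-cases _ (yes refl) (yes refl) _ = contradiction (refl , refl) ¬ba
    by-cases _ (yes refl) _ (yes refl) = loop

module _ {n : ℕ} (X Y : DiGraph n) where

  record DFSMove (c d : Fin n) (σ τ : Vec (Fin n) n) : Set where
    constructor dfs-move
    field
      edgeˣ  : Edge X c d
      edgeʸ  : Edge Y (lookup σ c) (lookup σ d)
      target : τ ≡ swapAt σ c d

  DFSStep : Vec (Fin n) n → Vec (Fin n) n → Set
  DFSStep σ τ = ∃₂ λ c d → DFSMove c d σ τ

  dfsEdge⇔DFSStep : ∀ σ τ → dfsEdge X Y σ τ ≡ true ⇔ DFSStep σ τ
  dfsEdge⇔DFSStep σ τ = mk⇔ sound complete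
    where
    move-test : Fin n → Fin n → Bool
    move-test c d = not (c == d) ∧ adj X c d ∧ adj Y (lookup σ c) (lookup σ d) ∧ vecEq τ (swapAt σ c d)

    sound : dfsEdge X Y σ τ ≡ true → DFSStep σ τ
    sound edge
      with c , row ← satisfied (any⁻ _ (allFin n) (Equivalence.from T-≡ edge))
      with d , test ← satisfied (any⁻ (move-test c) (allFin n) row)
      with _ , test′ ← Equivalence.to (T-∧ {not (c == d)}) test
      with cd∈X , test″ ← Equivalence.to (T-∧ {adj X c d}) test′
      with σcd∈Y , τ≡σ′ ← Equivalence.to (T-∧ {adj Y (lookup σ c) (lookup σ d)}) test″
      = c , d , dfs-move (Equivalence.to T-≡ cd∈X) (Equivalence.to T-≡ σcd∈Y) (toWitness τ≡σ′)

    complete : DFSStep σ τ → dfsEdge X Y σ τ ≡ true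
    complete (c , d , dfs-move cd∈X σcd∈Y τ≡σ′) =
      Equivalence.to T-≡ (any⁺ _ (lose (∈-allFin c) (any⁺ (move-test c) (lose (∈-allFin d) test))))
      where
      c≢d : c ≢ d
      c≢d refl with () ← trans (sym cd∈X) (loopless X c)
      test : T (move-test c d)
      test = Equivalence.from T-∧ (fromWitnessFalse {a? = c ≟ d} c≢d ,
             Equivalence.from T-∧ (Equivalence.from T-≡ cd∈X ,
             Equivalence.from T-∧ (Equivalence.from T-≡ σcd∈Y , fromWitness {a? = ≡-dec _≟_ τ (swapAt σ c d)} τ≡σ′)))

isYes-suc≟suc : ∀ m k → ⌊ suc m ℕ.≟ suc k ⌋ ≡ ⌊ m ℕ.≟ k ⌋
isYes-suc≟suc m k with suc m ℕ.≟ suc k | m ℕ.≟ k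
... | yes _       | yes _   = refl
... | yes 1+m≡1+k | no m≢k  = contradiction (suc-injective 1+m≡1+k) m≢k
... | no 1+m≢1+k  | yes m≡k = contradiction (cong suc m≡k) 1+m≢1+k
... | no _        | no _    = refl

ODP-counts : ∀ {n} → DiGraph n → DiGraph n → Fin n → Fin n → ℕ → Vec (Fin n) n → Bool
ODP-counts X Y c d k σ = adj Y (lookup σ c) (lookup σ d) ∧ ⌊ outdeg X Y σ ℕ.≟ k ⌋

module _ {n : ℕ} (X Y : DiGraph n) {a b : Fin n} (ab∈X : Edge X a b)
         (se : SelfEquivalent X (⁅ a ⁆ ∪ ⁅ b ⁆)) where

  private
    π : Fin n → Fin n
    π = transpose a b

  swapAB : Vec (Fin n) n → Vec (Fin n) n
  swapAB σ = swapAt σ a b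

  swapAB-involutive : ∀ σ → swapAB (swapAB σ) ≡ σ
  swapAB-involutive = swapAt-involutive a b

  a≢b : a ≢ b
  a≢b refl with () ← trans (sym ab∈X) (loopless X a)

  no-move-ba : ∀ {σ ρ} → ¬ DFSMove X Y b a σ ρ
  no-move-ba (dfs-move ba∈X _ _) with () ← trans (sym ba∈X) (asym X a b ab∈X)

  no-move-ab-from-swapAB : ∀ σ {ρ} → Edge Y (lookup σ a) (lookup σ b) → ¬ DFSMove X Y a b (swapAB σ) ρ
  no-move-ab-from-swapAB σ σab∈Y (dfs-move _ σ′ab∈Y _)
    with () ← trans (sym σ′ab∈Y) (trans (cong₂ (adj Y) (lookup-swapAtˡ σ a b) (lookup-swapAtʳ σ a b)) (asym Y _ _ σab∈Y))

  move-swapAB : ∀ {c d σ ρ} → ¬ (c ≡ a × d ≡ b) →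
                DFSMove X Y c d σ ρ → DFSMove X Y (π c) (π d) (swapAB σ) (swapAB ρ)
  move-swapAB {c} {d} {σ} ¬ab move@(dfs-move cd∈X σcd∈Y refl) = dfs-move
    (trans (adj-transpose X se ¬ab ¬ba) cd∈X)
    (subst₂ (Edge Y) (sym (lookup-swapAt-transpose σ a b c)) (sym (lookup-swapAt-transpose σ a b d)) σcd∈Y)
    (swapAt-swapAt a b c d σ)
    where
    ¬ba : ¬ (c ≡ b × d ≡ a)
    ¬ba (refl , refl) = no-move-ba move

  step-swapAB : ∀ {σ ρ} → ρ ≢ swapAB σ → DFSStep X Y σ ρ → DFSStep X Y (swapAB σ) (swapAB ρ)
  step-swapAB ρ≢σ′ (c , d , move) = π c , π d , move-swapAB ¬ab move
    where
    ¬ab : ¬ (c ≡ a × d ≡ b)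
    ¬ab (refl , refl) = ρ≢σ′ (DFSMove.target move)

  step-swapAB⁻ : ∀ {σ ρ} → Edge Y (lookup σ a) (lookup σ b) →
                 DFSStep X Y (swapAB σ) (swapAB ρ) → DFSStep X Y σ ρ
  step-swapAB⁻ {σ} {ρ} σab∈Y (c , d , move) =
    π c , π d , subst₂ (DFSMove X Y (π c) (π d)) (swapAB-involutive σ) (swapAB-involutive ρ) (move-swapAB ¬ab move)
    where
    ¬ab : ¬ (c ≡ a × d ≡ b)
    ¬ab (refl , refl) = no-move-ab-from-swapAB σ σab∈Y move

  no-step-back : ∀ σ → Injective _≡_ _≡_ (lookup σ) → Edge Y (lookup σ a) (lookup σ b) →
                 ¬ DFSStep X Y (swapAB σ) σ
  no-step-back σ σ! σab∈Y (c , d , move@(dfs-move _ _ σ≡)) = by-cases (a ≟ c) (a ≟ d)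
    where
    -- σ = σ ∘ (a b) ∘ (c d) with σ injective forces {c, d} = {a, b}, and neither order is a move.
    σa≡ : lookup σ a ≡ lookup σ (π (transpose c d a))
    σa≡ = trans (cong (λ v → lookup v a) σ≡) (trans (lookup-swapAt (swapAB σ) c d a) (lookup-swapAt σ a b _))
    b≡ : b ≡ transpose c d a
    b≡ = trans (sym (transpose-matchˡ a b)) (trans (cong π (σ! σa≡)) (transpose-involutive a b _))
    by-cases : Dec (a ≡ c) → Dec (a ≡ d) → ⊥
    by-cases (yes refl) _ =
      no-move-ab-from-swapAB σ σab∈Y (subst (λ x → DFSMove X Y a x _ _) (sym (trans b≡ (transpose-matchˡ a d))) move)
    by-cases (no _) (yes refl) =
      no-move-ba (subst (λ x → DFSMove X Y x a _ _) (sym (trans b≡ (transpose-matchʳ c a))) move)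
    by-cases (no a≢c) (no a≢d) = a≢b (sym (trans b≡ (transpose-fix a≢c a≢d)))

  outdeg-swapAB : ∀ {σ} → σ ∈ Perms n → Edge Y (lookup σ a) (lookup σ b) →
                  outdeg X Y σ ≡ suc (outdeg X Y (swapAB σ))
  outdeg-swapAB {σ} σ∈ σab∈Y = begin
    length (filterᵇ (dfsEdge X Y σ) (Perms n))
      ≡⟨ length-filterᵇ-except Perms-unique (swapAt-∈-Perms a b σ∈) step-forward no-step-from-swapAB transport ⟩
    suc (length (filterᵇ (dfsEdge X Y (swapAB σ) ∘ swapAB) (Perms n)))
      ≡⟨ cong suc (length-filterᵇ-involution _ swapAB-involutive (swapAt-∈-Perms a b) Perms-unique) ⟨
    suc (length (filterᵇ (dfsEdge X Y (swapAB σ)) (Perms n))) ∎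
    where
    open ≡-Reasoning
    step-forward : dfsEdge X Y σ (swapAB σ) ≡ true
    step-forward = Equivalence.from (dfsEdge⇔DFSStep X Y σ _) (a , b , dfs-move ab∈X σab∈Y refl)
    no-step-from-swapAB : dfsEdge X Y (swapAB σ) (swapAB (swapAB σ)) ≡ false
    no-step-from-swapAB rewrite swapAB-involutive σ =
      ¬-not (no-step-back σ (∈-Perms⁻ σ∈) σab∈Y ∘ Equivalence.to (dfsEdge⇔DFSStep X Y _ σ))
    transport : ∀ ρ → ρ ≢ swapAB σ → dfsEdge X Y σ ρ ≡ dfsEdge X Y (swapAB σ) (swapAB ρ)
    transport ρ ρ≢σ′ = ⇔→≡ (⇔.trans (dfsEdge⇔DFSStep X Y σ ρ)
                            (⇔.trans (mk⇔ (step-swapAB ρ≢σ′) (step-swapAB⁻ σab∈Y))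
                                     (⇔.sym (dfsEdge⇔DFSStep X Y _ _))))

  ODP-zero : ODP X Y a b 0 ≡ 0
  ODP-zero = cong length (filter-none (T? ∘ ODP-counts X Y a b 0) (All.tabulate λ σ∈ → subst T (counts-zero σ∈)))
    where
    counts-zero : ∀ {σ} → σ ∈ Perms n → ODP-counts X Y a b 0 σ ≡ false
    counts-zero {σ} σ∈ with adj Y (lookup σ a) (lookup σ b) in σab∈Y
    ... | true rewrite outdeg-swapAB σ∈ σab∈Y = refl
    ... | false = refl

  ODP-suc : ∀ k → ODP X Y a b (suc k) ≡ ODP X Y b a k
  ODP-suc k = begin
    length (filterᵇ (ODP-counts X Y a b (suc k)) (Perms n))
      ≡⟨ cong length (filterᵇ-cong-∈ (Perms n) counts-suc) ⟩
    length (filterᵇ (ODP-counts X Y b a k ∘ swapAB) (Perms n))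
      ≡⟨ length-filterᵇ-involution (ODP-counts X Y b a k) swapAB-involutive (swapAt-∈-Perms a b) Perms-unique ⟨
    length (filterᵇ (ODP-counts X Y b a k) (Perms n)) ∎
    where
    open ≡-Reasoning
    counts-suc : ∀ {σ} → σ ∈ Perms n → ODP-counts X Y a b (suc k) σ ≡ ODP-counts X Y b a k (swapAB σ)
    counts-suc {σ} σ∈ rewrite lookup-swapAtˡ σ a b | lookup-swapAtʳ σ a b with adj Y (lookup σ a) (lookup σ b) in σab∈Y
    ... | true rewrite outdeg-swapAB σ∈ σab∈Y = isYes-suc≟suc (outdeg X Y (swapAB σ)) k
    ... | false = refl

theorem4p2 : (n : ℕ) (X Y : DiGraph n) (a b : Fin n) →
    Edge X a b → SelfEquivalent X (⁅ a ⁆ ∪ ⁅ b ⁆) →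
    ∀ (k : ℕ) → ODP X Y a b k ≡ (x· ODP X Y b a) k
theorem4p2 n X Y a b ab∈X se zero    = ODP-zero X Y ab∈X se
theorem4p2 n X Y a b ab∈X se (suc k) = ODP-suc X Y ab∈X se k
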